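{- For all integers $a\geq 2$ and $b\geq 3$, the augmented saltire graph ${AS}_{a,b}$ is claw-contractible-free. In particular, for $n\geq 3$ the graphs ${AS}_{n,n}$ and ${AS}_{n,n+1}$ are claw-contractible-free.
   Context: All graphs are finite and simple. The claw is $K_{1,3}$. A graph $G$ contracts to the claw if there is a subset $S$ of its edges such that contracting the edges of $S$ and replacing multiple edges by single edges yields the claw; $G$ is claw-contractible-free if it does not contract to the claw. For $a\geq 2$, $b\geq 3$, the augmented saltire graph ${AS}_{a,b}$ is the graph on vertices $v_1,\dots,v_{a+b}$ with edges $v_iv_{i+1}$ for $1\leq i\leq a+b-1$, together with $v_{a+b}v_1$, $v_1v_{a+1}$, $v_2v_{a+2}$ and $v_1v_{a+2}$. -}

module Defs where

open import Data.Nat using (ℕ; zero; suc; _+_; _∸_)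
open import Data.Fin using (Fin; toℕ)
open import Data.Product using (Σ; _×_; ∃)
open import Data.Sum using (_⊎_)
open import Relation.Binary.PropositionalEquality using (_≡_)
open import Relation.Nullary using (¬_)
open import Relation.Binary.Construct.Closure.Equivalence using (EqClosure)

record Graph : Set₁ where
  field
    n   : ℕ
    Adj : Fin n → Fin n → Set
open Graph public

ClawAdj : Fin 4 → Fin 4 → Set
ClawAdj i j = (toℕ i ≡ 0 × ¬ (toℕ j ≡ 0)) ⊎ (¬ (toℕ i ≡ 0) × toℕ j ≡ 0)

-- G contracts to the claw: there is a set S of edges of G (a relation
-- contained in Adj; S u v means the edge uv is in S) such that the graph
-- obtained by contracting S (vertices = connected components of (V, S),
-- two components adjacent iff some edge of G joins them, multi-edges and
-- loops removed) is isomorphic to the claw.  The isomorphism is encoded by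
-- f : V → Fin 4 whose fibres are exactly the components of (V, S).
ContractsToClaw : Graph → Set₁
ContractsToClaw G =
  Σ (Fin (n G) → Fin (n G) → Set) λ S →
  Σ (Fin (n G) → Fin 4) λ f →
    (∀ u v → S u v → Adj G u v)
  × (∀ u v → S u v → f u ≡ f v)
  × (∀ u v → f u ≡ f v → EqClosure S u v)
  × (∀ i → ∃ λ u → f u ≡ i)
  × (∀ i j → ¬ (i ≡ j) →
       (ClawAdj i j → ∃ λ u → ∃ λ v → Adj G u v × f u ≡ i × f v ≡ j)
     × ((∃ λ u → ∃ λ v → Adj G u v × f u ≡ i × f v ≡ j) → ClawAdj i j))

ClawContractibleFree : Graph → Set₁
ClawContractibleFree G = ¬ ContractsToClaw G

-- Edges of AS_{a,b}, with vertex v_{k+1} represented by index k (0-based).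
ASEdge : ℕ → ℕ → ℕ → ℕ → Set
ASEdge a b x y =
    (suc x ≡ y)
  ⊎ (x ≡ a + b ∸ 1 × y ≡ 0)
  ⊎ (x ≡ 0 × y ≡ a)
  ⊎ (x ≡ 1 × y ≡ suc a)
  ⊎ (x ≡ 0 × y ≡ suc a)

AS : ℕ → ℕ → Graph
AS a b = record
  { n   = a + b
  ; Adj = λ x y → ASEdge a b (toℕ x) (toℕ y) ⊎ ASEdge a b (toℕ y) (toℕ x)
  }

-- Number the vertices 0, …, a+b-1 and suppose f maps AS_{a,b} onto the claw
-- with S-connected fibres; let C be the fibre of the centre.  Two distinct leaf fibres are never
-- adjacent, so every edge leaving a leaf vertex towards another fibre ends in
-- C, and C is connected.  Pick leaf representatives p < q < r from the three
-- leaf fibres.  Walking along the Hamiltonian path 0, 1, …, a+b-1, the fibre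
-- changes between p and q, and between q and r, so C meets both open
-- intervals (p,q) and (q,r).  Apart from path edges, only the chord ends
-- 0, 1, a, a+1, a+b-1 have neighbours far away.  If none of 1, a, a+1 lies
-- inside (p,q), the only vertices outside (p,q) adjacent to it are p and q,
-- which are not in C, so the connected set C is trapped in (p,q) although it
-- meets (q,r); similarly for (q,r).  Otherwise p = 0 and r > a; then the last
-- vertex, adjacent to p, lies in the fibre of neither p nor r, so C meets the
-- tail (r, a+b-1], whose only outside neighbours are r and 0 = p; again C is
-- trapped, although it meets (p,q).

module Submission where

open import Data.Empty using (⊥; ⊥-elim)
open import Data.Fin as Fin using (Fin; zero; suc; toℕ; fromℕ; fromℕ<; #_)
open import Data.Fin.Properties as Finₚ
  using (toℕ-injective; toℕ-fromℕ; toℕ-fromℕ<; toℕ<n; toℕ≤pred[n])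
open import Data.Nat using (ℕ; zero; suc; _+_; _∸_; _≤_; _<_; z≤n; z<s; _<?_)
open import Data.Nat.Properties
open import Data.Product using (Σ; ∃-syntax; _×_; _,_; proj₁; proj₂)
open import Data.Sum using (_⊎_; inj₁; inj₂; [_,_]′)
open import Function using (_∘_; _∘′_; case_of_)
open import Level using (0ℓ)
open import Relation.Binary.Core using (Rel)
open import Relation.Binary.Definitions using (Symmetric; Irreflexive; tri<; tri≈; tri>)
open import Relation.Binary.PropositionalEquality
open import Relation.Nullary using (¬_; Dec; yes; no)
open import Relation.Nullary.Decidable using (_×-dec_; _⊎-dec_)
open import Relation.Unary using (Pred; Decidable)
open import Relation.Binary.Construct.Closure.Equivalence using (EqClosure)
open import Relation.Binary.Construct.Closure.ReflexiveTransitive using (ε; _◅_)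
open import Relation.Binary.Construct.Closure.Symmetric using (SymClosure; fwd; bwd)

open import Defs

module _ {n} {R : Rel (Fin n) 0ℓ} (R-sym : Symmetric R) (R-irrefl : Irreflexive _≡_ R) where

  no-increasing-triangle⇒no-triangle :
    (∀ {i j k} → R i j → R j k → R i k → toℕ i < toℕ j → toℕ j < toℕ k → ⊥) →
    ∀ {i j k} → R i j → R j k → R i k → ⊥
  no-increasing-triangle⇒no-triangle none {i} {j} {k} ij jk ik
    with Finₚ.<-cmp i j | Finₚ.<-cmp j k | Finₚ.<-cmp i k
  ... | tri≈ _ i≡j _ | _ | _ = R-irrefl i≡j ij
  ... | _ | tri≈ _ j≡k _ | _ = R-irrefl j≡k jk
  ... | _ | _ | tri≈ _ i≡k _ = R-irrefl i≡k ik
  ... | tri< i<j _ _ | tri< j<k _ _ | _           = none ij jk ik i<j j<k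
  ... | tri< i<j _ _ | tri> _ _ k<j | tri< i<k _ _ = none ik (R-sym jk) ij i<k k<j
  ... | tri< i<j _ _ | tri> _ _ k<j | tri> _ _ k<i = none (R-sym ik) ij (R-sym jk) k<i i<j
  ... | tri> _ _ j<i | tri< j<k _ _ | tri< i<k _ _ = none (R-sym ij) ik jk j<i i<k
  ... | tri> _ _ j<i | tri< j<k _ _ | tri> _ _ k<i = none jk (R-sym ik) (R-sym ij) j<k k<i
  ... | tri> _ _ j<i | tri> _ _ k<j | _           = none (R-sym jk) (R-sym ij) (R-sym ik) k<j j<i

next-vertex : ∀ {n} {u v : Fin n} → toℕ u < toℕ v → Σ (Fin n) λ w → toℕ w ≡ suc (toℕ u)
next-vertex {v = v} u<v = fromℕ< (≤-<-trans u<v (toℕ<n v)) , toℕ-fromℕ< _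

last-vertex : ∀ {n} (r : Fin n) → Σ (Fin n) λ ℓ → toℕ ℓ ≡ n ∸ 1 × toℕ r ≤ toℕ ℓ
last-vertex {suc k} r = fromℕ k , toℕ-fromℕ k , subst (toℕ r ≤_) (sym (toℕ-fromℕ k)) (toℕ≤pred[n] r)

nothing-beyond-last : ∀ {n t} → t < n → ¬ (n ∸ 1 < t)
nothing-beyond-last {suc k} t<n k<t = <⇒≱ k<t (≤-pred t<n)

module StarContraction
  (G : Graph) (Adj-sym : Symmetric (Adj G)) {m : ℕ}
  (S : Rel (Fin (n G)) 0ℓ) (f : Fin (n G) → Fin (suc m))
  (S⊆Adj : ∀ u v → S u v → Adj G u v)
  (S⊆ker : ∀ u v → S u v → f u ≡ f v)
  (ker⊆S* : ∀ u v → f u ≡ f v → EqClosure S u v)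
  (leaves-nonadjacent : ∀ u v → Adj G u v → f u ≢ f v → f u ≡ zero ⊎ f v ≡ zero)
  where

  V : Set
  V = Fin (n G)

  Centre : Pred V 0ℓ
  Centre u = f u ≡ zero

  DistinctLeaves : Rel V 0ℓ
  DistinctLeaves u v = ¬ Centre u × ¬ Centre v × f u ≢ f v

  DistinctLeaves-sym : Symmetric DistinctLeaves
  DistinctLeaves-sym (¬cu , ¬cv , fu≢fv) = ¬cv , ¬cu , fu≢fv ∘′ sym

  DistinctLeaves-irrefl : Irreflexive _≡_ DistinctLeaves
  DistinctLeaves-irrefl refl (_ , _ , fu≢fu) = fu≢fu refl

  centre-unseparated : (In : Pred V 0ℓ) → Decidable In →
    (∀ {x y} → Adj G x y → In x → ¬ In y → ¬ Centre y) →
    ∀ {c c'} → Centre c → Centre c' → In c → In c'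
  centre-unseparated In In? boundary {c} {c'} cc cc' =
    walk (ker⊆S* c c' (trans cc (sym cc'))) cc
    where
      same-fibre : ∀ {x y} → SymClosure S x y → f x ≡ f y
      same-fibre (fwd s) = S⊆ker _ _ s
      same-fibre (bwd s) = sym (S⊆ker _ _ s)

      adjacent : ∀ {x y} → SymClosure S x y → Adj G x y
      adjacent (fwd s) = S⊆Adj _ _ s
      adjacent (bwd s) = Adj-sym (S⊆Adj _ _ s)

      walk : ∀ {x} → EqClosure S x c' → Centre x → In x → In c'
      walk ε _ in-x = in-x
      walk (_◅_ {j = y} s path) cx in-x with In? y
      ... | yes in-y = walk path (trans (sym (same-fibre s)) cx) in-y
      ... | no ¬in-y = ⊥-elim (boundary (adjacent s) in-x ¬in-y (trans (sym (same-fibre s)) cx))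

  module _ (path : ∀ u v → toℕ v ≡ suc (toℕ u) → Adj G u v) where

    fibre-change⇒centre : ∀ {u v} → toℕ u ≤ toℕ v → ¬ Centre u → f u ≢ f v →
      ∃[ w ] toℕ u < toℕ w × toℕ w ≤ toℕ v × Centre w
    fibre-change⇒centre {u} {v} u≤v = go (toℕ v ∸ toℕ u) (m+[n∸m]≡n u≤v)
      where
        go : ∀ {u} d → toℕ u + d ≡ toℕ v → ¬ Centre u → f u ≢ f v →
          ∃[ w ] toℕ u < toℕ w × toℕ w ≤ toℕ v × Centre w
        go zero u+0≡v _ fu≢fv =
          ⊥-elim (fu≢fv (cong f (toℕ-injective (trans (sym (+-identityʳ _)) u+0≡v))))
        go {u} (suc d) u+d≡v ¬cu fu≢fv =
          let u<v = subst (toℕ u <_) u+d≡v (m<m+n (toℕ u) z<s)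
              u⁺ , u⁺≡1+u = next-vertex u<v
              u<u⁺ = ≤-reflexive (sym u⁺≡1+u)
          in  case f u Fin.≟ f u⁺ of λ where
                (no fu≢fu⁺) →
                  [ ⊥-elim ∘ ¬cu
                  , (λ cu⁺ → u⁺ , u<u⁺ , subst (_≤ toℕ v) (sym u⁺≡1+u) u<v , cu⁺)
                  ]′ (leaves-nonadjacent u u⁺ (path u u⁺ u⁺≡1+u) fu≢fu⁺)
                (yes fu≡fu⁺) →
                  let u⁺+d≡v = trans (cong (_+ d) u⁺≡1+u) (trans (sym (+-suc (toℕ u) d)) u+d≡v)
                      w , u⁺<w , w≤v , cw = go d u⁺+d≡v (¬cu ∘′ trans fu≡fu⁺) (fu≢fv ∘′ trans fu≡fu⁺)
                  in  w , <-trans u<u⁺ u⁺<w , w≤v , cw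

    centre-between : ∀ {p q} → DistinctLeaves p q → toℕ p < toℕ q →
      ∃[ w ] toℕ p < toℕ w × toℕ w < toℕ q × Centre w
    centre-between (¬cp , ¬cq , fp≢fq) p<q =
      let w , p<w , w≤q , cw = fibre-change⇒centre (<⇒≤ p<q) ¬cp fp≢fq
      in  w , p<w , ≤∧≢⇒< w≤q (λ w≡q → ¬cq (subst Centre (toℕ-injective w≡q) cw)) , cw

Inside : ℕ → ℕ → ℕ → Set
Inside s t x = s < x × x < t

-- The chord ends other than 0 and a+b-1, which cannot lie strictly inside an
-- interval of vertices.
Hub : ℕ → ℕ → Set
Hub a x = x ≡ 1 ⊎ x ≡ a ⊎ x ≡ suc a

HubInside : ℕ → ℕ → ℕ → Set
HubInside a s t = Inside s t 1 ⊎ Inside s t a ⊎ Inside s t (suc a)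

Inside? : ∀ s t x → Dec (Inside s t x)
Inside? s t x = (s <? x) ×-dec (x <? t)

HubInside? : ∀ a s t → Dec (HubInside a s t)
HubInside? a s t = Inside? s t 1 ⊎-dec Inside? s t a ⊎-dec Inside? s t (suc a)

hub-inside : ∀ {a s t x} → Hub a x → Inside s t x → HubInside a s t
hub-inside (inj₁ refl)        = inj₁
hub-inside (inj₂ (inj₁ refl)) = inj₂ ∘′ inj₁
hub-inside (inj₂ (inj₂ refl)) = inj₂ ∘′ inj₂

-- Two consecutive intervals can both contain a hub only by using 1 and then
-- a or a+1, because a and a+1 are adjacent integers.
hubs-inside-consecutive : ∀ {a p q r} → HubInside a p q → HubInside a q r → p ≡ 0 × a < r
hubs-inside-consecutive (inj₁ (p<1 , 1<q)) (inj₁ (q<1 , _)) = ⊥-elim (<-asym q<1 1<q)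
hubs-inside-consecutive (inj₁ (p<1 , _)) (inj₂ (inj₁ (_ , a<r))) = n<1⇒n≡0 p<1 , a<r
hubs-inside-consecutive (inj₁ (p<1 , _)) (inj₂ (inj₂ (_ , a+1<r))) = n<1⇒n≡0 p<1 , <-trans (n<1+n _) a+1<r
hubs-inside-consecutive (inj₂ (inj₁ (_ , a<q))) (inj₁ (q<1 , _)) = ⊥-elim (<⇒≱ a<q (≤-trans (≤-pred q<1) z≤n))
hubs-inside-consecutive (inj₂ (inj₁ (_ , a<q))) (inj₂ (inj₁ (q<a , _))) = ⊥-elim (<-asym a<q q<a)
hubs-inside-consecutive (inj₂ (inj₁ (_ , a<q))) (inj₂ (inj₂ (q<a+1 , _))) = ⊥-elim (<⇒≱ a<q (≤-pred q<a+1))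
hubs-inside-consecutive (inj₂ (inj₂ (_ , a+1<q))) (inj₁ (q<1 , _)) = ⊥-elim (<⇒≱ a+1<q (≤-trans (≤-pred q<1) z≤n))
hubs-inside-consecutive (inj₂ (inj₂ (_ , a+1<q))) (inj₂ (inj₁ (q<a , _))) = ⊥-elim (<-asym (<-trans (n<1+n _) a+1<q) q<a)
hubs-inside-consecutive (inj₂ (inj₂ (_ , a+1<q))) (inj₂ (inj₂ (q<a+1 , _))) = ⊥-elim (<-asym a+1<q q<a+1)

ASAdjℕ : ℕ → ℕ → ℕ → ℕ → Set
ASAdjℕ a b x y = ASEdge a b x y ⊎ ASEdge a b y x

ASAdjℕ-cases : ∀ {a b x y} → ASAdjℕ a b x y →
  y ≡ suc x ⊎ x ≡ suc y ⊎ x ≡ 0 ⊎ (x ≡ a + b ∸ 1 × y ≡ 0) ⊎ Hub a x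
ASAdjℕ-cases (inj₁ (inj₁ refl))                              = inj₁ refl
ASAdjℕ-cases (inj₁ (inj₂ (inj₁ last-0)))                     = inj₂ (inj₂ (inj₂ (inj₁ last-0)))
ASAdjℕ-cases (inj₁ (inj₂ (inj₂ (inj₁ (x≡0 , _)))))           = inj₂ (inj₂ (inj₁ x≡0))
ASAdjℕ-cases (inj₁ (inj₂ (inj₂ (inj₂ (inj₁ (x≡1 , _))))))    = inj₂ (inj₂ (inj₂ (inj₂ (inj₁ x≡1))))
ASAdjℕ-cases (inj₁ (inj₂ (inj₂ (inj₂ (inj₂ (x≡0 , _))))))    = inj₂ (inj₂ (inj₁ x≡0))
ASAdjℕ-cases (inj₂ (inj₁ refl))                              = inj₂ (inj₁ refl)
ASAdjℕ-cases (inj₂ (inj₂ (inj₁ (_ , x≡0))))                  = inj₂ (inj₂ (inj₁ x≡0))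
ASAdjℕ-cases (inj₂ (inj₂ (inj₂ (inj₁ (_ , x≡a)))))           = inj₂ (inj₂ (inj₂ (inj₂ (inj₂ (inj₁ x≡a)))))
ASAdjℕ-cases (inj₂ (inj₂ (inj₂ (inj₂ (inj₁ (_ , x≡a+1))))))  = inj₂ (inj₂ (inj₂ (inj₂ (inj₂ (inj₂ x≡a+1)))))
ASAdjℕ-cases (inj₂ (inj₂ (inj₂ (inj₂ (inj₂ (_ , x≡a+1))))))  = inj₂ (inj₂ (inj₂ (inj₂ (inj₂ (inj₂ x≡a+1)))))

interval-exit : ∀ {a b s t x y} → t < a + b → ¬ HubInside a s t →
  ASAdjℕ a b x y → Inside s t x → ¬ Inside s t y → y ≡ s ⊎ y ≡ t
interval-exit {x = x} t<n no-hub xy (s<x , x<t) y-outside with ASAdjℕ-cases xy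
... | inj₁ refl with m≤n⇒m<n∨m≡n x<t
...   | inj₁ y<t = ⊥-elim (y-outside (<-trans s<x (n<1+n x) , y<t))
...   | inj₂ y≡t = inj₂ y≡t
interval-exit {y = y} t<n no-hub xy (s<x , x<t) y-outside | inj₂ (inj₁ refl)
  with m≤n⇒m<n∨m≡n (≤-pred s<x)
... | inj₁ s<y = ⊥-elim (y-outside (s<y , <-trans (n<1+n y) x<t))
... | inj₂ s≡y = inj₁ (sym s≡y)
interval-exit t<n no-hub xy (s<x , x<t) y-outside | inj₂ (inj₂ (inj₁ refl)) = ⊥-elim (n≮0 s<x)
interval-exit t<n no-hub xy (s<x , x<t) y-outside | inj₂ (inj₂ (inj₂ (inj₁ (refl , _)))) =
  ⊥-elim (nothing-beyond-last t<n x<t)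
interval-exit t<n no-hub xy x-inside y-outside | inj₂ (inj₂ (inj₂ (inj₂ hub))) =
  ⊥-elim (no-hub (hub-inside hub x-inside))

tail-exit : ∀ {a b r x y} → a < r → ASAdjℕ a b x y → r < x → ¬ r < y → y ≡ r ⊎ y ≡ 0
tail-exit {x = x} a<r xy r<x r≮y with ASAdjℕ-cases xy
... | inj₁ refl = ⊥-elim (r≮y (<-trans r<x (n<1+n x)))
... | inj₂ (inj₁ refl) = inj₁ (sym (≤∧≮⇒≡ (≤-pred r<x) r≮y))
... | inj₂ (inj₂ (inj₁ refl)) = ⊥-elim (n≮0 r<x)
... | inj₂ (inj₂ (inj₂ (inj₁ (_ , y≡0)))) = inj₂ y≡0
... | inj₂ (inj₂ (inj₂ (inj₂ (inj₁ refl)))) = ⊥-elim (<⇒≱ a<r (≤-trans (≤-pred r<x) z≤n))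
... | inj₂ (inj₂ (inj₂ (inj₂ (inj₂ (inj₁ refl))))) = ⊥-elim (<-asym a<r r<x)
... | inj₂ (inj₂ (inj₂ (inj₂ (inj₂ (inj₂ refl))))) = ⊥-elim (<⇒≱ a<r (≤-pred r<x))

module ASContraction (a b : ℕ)
  (S : Rel (Fin (a + b)) 0ℓ) (f : Fin (a + b) → Fin 4)
  (S⊆Adj : ∀ u v → S u v → Adj (AS a b) u v)
  (S⊆ker : ∀ u v → S u v → f u ≡ f v)
  (ker⊆S* : ∀ u v → f u ≡ f v → EqClosure S u v)
  (leaves-nonadjacent : ∀ u v → Adj (AS a b) u v → f u ≢ f v → f u ≡ zero ⊎ f v ≡ zero)
  where

  AS-sym : Symmetric (Adj (AS a b))
  AS-sym (inj₁ e) = inj₂ e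
  AS-sym (inj₂ e) = inj₁ e

  AS-path : ∀ u v → toℕ v ≡ suc (toℕ u) → Adj (AS a b) u v
  AS-path u v v≡1+u = inj₁ (inj₁ (sym v≡1+u))

  open StarContraction (AS a b) AS-sym S f S⊆Adj S⊆ker ker⊆S* leaves-nonadjacent public

  ¬Centre-at : ∀ {u v} → ¬ Centre u → toℕ v ≡ toℕ u → ¬ Centre v
  ¬Centre-at ¬cu v≡u = ¬cu ∘′ subst Centre (toℕ-injective v≡u)

  centre-trapped-in-interval : ∀ {s t} → ¬ HubInside a (toℕ s) (toℕ t) → DistinctLeaves s t →
    ∀ {c c'} → Centre c → Centre c' → Inside (toℕ s) (toℕ t) (toℕ c) → Inside (toℕ s) (toℕ t) (toℕ c')
  centre-trapped-in-interval {s} {t} no-hub (¬cs , ¬ct , _) =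
    centre-unseparated (Inside (toℕ s) (toℕ t) ∘ toℕ) (Inside? (toℕ s) (toℕ t) ∘ toℕ) boundary
    where
      boundary : ∀ {x y} → Adj (AS a b) x y → Inside (toℕ s) (toℕ t) (toℕ x) → ¬ Inside (toℕ s) (toℕ t) (toℕ y) → ¬ Centre y
      boundary xy x-inside y-outside with interval-exit (toℕ<n t) no-hub xy x-inside y-outside
      ... | inj₁ y≡s = ¬Centre-at ¬cs y≡s
      ... | inj₂ y≡t = ¬Centre-at ¬ct y≡t

  centre-trapped-in-tail : ∀ {p r} → toℕ p ≡ 0 → a < toℕ r → DistinctLeaves p r →
    ∀ {c c'} → Centre c → Centre c' → toℕ r < toℕ c → toℕ r < toℕ c'
  centre-trapped-in-tail {p} {r} p≡0 a<r (¬cp , ¬cr , _) =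
    centre-unseparated (λ x → toℕ r < toℕ x) (λ x → toℕ r <? toℕ x) boundary
    where
      boundary : ∀ {x y} → Adj (AS a b) x y → toℕ r < toℕ x → ¬ toℕ r < toℕ y → ¬ Centre y
      boundary xy r<x r≮y with tail-exit a<r xy r<x r≮y
      ... | inj₁ y≡r = ¬Centre-at ¬cr y≡r
      ... | inj₂ y≡0 = ¬Centre-at ¬cp (trans y≡0 (sym p≡0))

  last-vertex-leaves-fibre : ∀ {p r} → toℕ p ≡ 0 → DistinctLeaves p r →
    ∀ {ℓ} → toℕ ℓ ≡ a + b ∸ 1 → f ℓ ≢ f r
  last-vertex-leaves-fibre p≡0 (¬cp , ¬cr , fp≢fr) {ℓ} ℓ≡last fℓ≡fr
    with leaves-nonadjacent ℓ _ (inj₁ (inj₂ (inj₁ (ℓ≡last , p≡0)))) (λ fℓ≡fp → fp≢fr (trans (sym fℓ≡fp) fℓ≡fr))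
  ... | inj₁ cℓ = ¬cr (trans (sym fℓ≡fr) cℓ)
  ... | inj₂ cp = ¬cp cp

  centre-beyond-leaf : ∀ {p r} → toℕ p ≡ 0 → DistinctLeaves p r → ∃[ c ] toℕ r < toℕ c × Centre c
  centre-beyond-leaf {r = r} p≡0 pr@(_ , ¬cr , _) =
    let ℓ , ℓ≡last , r≤ℓ = last-vertex r
        c , r<c , _ , cc = fibre-change⇒centre AS-path r≤ℓ ¬cr (last-vertex-leaves-fibre p≡0 pr ℓ≡last ∘ sym)
    in  c , r<c , cc

  no-increasing-leaf-triangle : ∀ {p q r} → DistinctLeaves p q → DistinctLeaves q r → DistinctLeaves p r →
    toℕ p < toℕ q → toℕ q < toℕ r → ⊥
  no-increasing-leaf-triangle {p} {q} {r} pq qr pr p<q q<r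
    with centre-between AS-path pq p<q | centre-between AS-path qr q<r
  ... | c , p<c , c<q , cc | c' , q<c' , c'<r , cc'
    with HubInside? a (toℕ p) (toℕ q) | HubInside? a (toℕ q) (toℕ r)
  ... | no no-hub | _ = <-asym q<c' (proj₂ (centre-trapped-in-interval no-hub pq cc cc' (p<c , c<q)))
  ... | yes _ | no no-hub = <-asym c<q (proj₁ (centre-trapped-in-interval no-hub qr cc' cc (q<c' , c'<r)))
  ... | yes hub-pq | yes hub-qr =
    let p≡0 , a<r = hubs-inside-consecutive hub-pq hub-qr
        c″ , r<c″ , cc″ = centre-beyond-leaf p≡0 pr
    in  <-asym (<-trans c<q q<r) (centre-trapped-in-tail p≡0 a<r pr cc″ cc r<c″)

AS-claw-contractible-free : ∀ a b → ClawContractibleFree (AS a b)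
AS-claw-contractible-free a b (S , f , S⊆Adj , S⊆ker , ker⊆S* , onto , quotient≅claw) =
  no-increasing-triangle⇒no-triangle DistinctLeaves-sym DistinctLeaves-irrefl no-increasing-leaf-triangle
    (leaves (# 1) (# 2) (λ ()) (λ ()) (λ ())) (leaves (# 2) (# 3) (λ ()) (λ ()) (λ ()))
    (leaves (# 1) (# 3) (λ ()) (λ ()) (λ ()))
  where
    leaves-nonadjacent : ∀ u v → Adj (AS a b) u v → f u ≢ f v → f u ≡ zero ⊎ f v ≡ zero
    leaves-nonadjacent u v uv fu≢fv with proj₂ (quotient≅claw (f u) (f v) fu≢fv) (u , v , uv , refl , refl)
    ... | inj₁ (fu≡0 , _) = inj₁ (toℕ-injective fu≡0)
    ... | inj₂ (_ , fv≡0) = inj₂ (toℕ-injective fv≡0)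

    open ASContraction a b S f S⊆Adj S⊆ker ker⊆S* leaves-nonadjacent

    leaves : ∀ i j → i ≢ zero → j ≢ zero → i ≢ j → DistinctLeaves (proj₁ (onto i)) (proj₁ (onto j))
    leaves i j i≢0 j≢0 i≢j with onto i | onto j
    ... | _ , refl | _ , refl = i≢0 , j≢0 , i≢j


lemma3p6 : ((a b : ℕ) → 2 ≤ a → 3 ≤ b → ClawContractibleFree (AS a b))
    × ((m : ℕ) → 3 ≤ m → ClawContractibleFree (AS m m) × ClawContractibleFree (AS m (suc m)))
lemma3p6 = (λ a b _ _ → AS-claw-contractible-free a b)
         , (λ m _ → AS-claw-contractible-free m m , AS-claw-contractible-free m (suc m))
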